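{- Let $f:\mathbb{N}_0\to\mathbb{C}$ with $f(0)\neq 0$. Then the identity $$(-1)^n(I\otimes_{\psi_m} f)(n)=(-1)^m(I\otimes_{\psi_n} f)(m)\quad\text{for all } m,n\in\mathbb{N}_0,$$ equivalently $(-1)^n\sum_{i=0}^n\binom{n}{i}f(m+i)=(-1)^m\sum_{i=0}^m\binom{m}{i}f(n+i)$ for all $m,n\in\mathbb{N}_0$, holds if and only if $I\bullet f=\nu f$, i.e. $\sum_{j=0}^k\binom{k}{j}f(j)=(-1)^kf(k)$ for all $k\in\mathbb{N}_0$. Furthermore, any such $f$ is determined by its values on the even nonnegative integers; precisely, for all $k\in\mathbb{N}_0$, $$f(2k+1)=-\sum_{i=0}^{k}\binom{2k+1}{2i+1}E_{2i+1}(1)\,f(2(k-i)).$$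
   Context: $\mathbb{N}_0$ is the set of nonnegative integers; an arithmetic function is a map $\mathbb{N}_0\to\mathbb{C}$. The Cauchy-type product is $(f\bullet g)(k):=\sum_{m=0}^{k}\binom{k}{m}f(m)g(k-m)$. $I$ is the arithmetic function with $I(k)=1$ for all $k$, $\nu(k)=(-1)^k$, and $(\nu f)(k):=(-1)^kf(k)$ (pointwise product). For $m\in\mathbb{N}_0$, $\psi_m:\mathbb{N}_0\to\mathbb{N}_0$ is $\psi_m(n)=m+n$, and $(f\otimes_{\psi_m}g)(n):=((f\circ\psi_m)\bullet(g\circ\psi_m))(n)$, where $\circ$ is composition of maps. $E_k(x)$ denotes the $k$th Euler polynomial, defined by $\frac{2e^{xt}}{e^t+1}=\sum_{k=0}^\infty E_k(x)\frac{t^k}{k!}$. -}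

module Defs where

open import Level using (Level)
open import Algebra.Bundles using (CommutativeRing)
open import Data.Nat using (ℕ; zero; suc; _∸_; _≟_) renaming (_+_ to _+ℕ_)
open import Data.Nat.Combinatorics using (_C_)
open import Relation.Nullary using (yes; no)

-- All definitions are relative to a commutative ring R (standing in for ℂ).
module _ {c ℓ : Level} (R : CommutativeRing c ℓ) where
  open CommutativeRing R

  natMul : ℕ → Carrier → Carrier
  natMul zero    x = 0#
  natMul (suc n) x = x + natMul n x

  pow : Carrier → ℕ → Carrier
  pow x zero    = 1#
  pow x (suc n) = x * pow x n

  signed : ℕ → Carrier → Carrier
  signed zero    x = x
  signed (suc k) x = - signed k x

  sumTo : ℕ → (ℕ → Carrier) → Carrier
  sumTo zero    g = g 0
  sumTo (suc n) g = sumTo n g + g (suc n)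

  sumBelow : ℕ → (ℕ → Carrier) → Carrier
  sumBelow zero    g = 0#
  sumBelow (suc n) g = sumBelow n g + g n

  bullet : (ℕ → Carrier) → (ℕ → Carrier) → ℕ → Carrier
  bullet f g k = sumTo k (λ m → natMul (k C m) (f m * g (k ∸ m)))

  I : ℕ → Carrier
  I _ = 1#

  νf : (ℕ → Carrier) → ℕ → Carrier
  νf f k = signed k (f k)

  ψ : ℕ → ℕ → ℕ
  ψ m n = m +ℕ n

  otimesψ : ℕ → (ℕ → Carrier) → (ℕ → Carrier) → ℕ → Carrier
  otimesψ m f g n = bullet (λ j → f (ψ m j)) (λ j → g (ψ m j)) n

  -- Euler polynomials E_k(x), given `half` = 1/2 in R.
  -- Comparing coefficients of t^n/n! in 2 e^{xt} = (e^t + 1) Σ E_k(x) t^k/k!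
  -- gives  2 E_n(x) + Σ_{j<n} C(n,j) E_j(x) = 2 x^n, i.e.
  --        E_n(x) = x^n - (1/2) Σ_{j<n} C(n,j) E_j(x).
  -- eulerTable n is correct on all j < n (course-of-values recursion).
  eulerTable : Carrier → Carrier → ℕ → ℕ → Carrier
  eulerTable half x zero    = λ _ → 0#
  eulerTable half x (suc n) j with j ≟ n
  ... | yes _ = pow x n - half * sumBelow n (λ i → natMul (n C i) (eulerTable half x n i))
  ... | no  _ = eulerTable half x n j

  euler : Carrier → ℕ → Carrier → Carrier
  euler half k x = eulerTable half x (suc k) k

module Submission where

-- Throughout, R is a commutative ring standing in for ℂ, sequences are maps
-- ℕ → R, and (X • Y)(n) = Σ_j C(n,j) X(j) Y(n-j) is the binomial convolution
-- (the product of exponential generating functions).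
--
-- 1. The binomial convolution obeys the product rule
--      (X • Y)(n+1) = (ΔX • Y)(n) + (X • ΔY)(n),   ΔX(j) = X(j+1),
--    a consequence of Pascal's rule.  Taking the product rule as a recursive
--    definition gives a convolution ⊛ whose algebra (commutativity,
--    distributivity, associativity) is proved by plain induction; it agrees
--    with • pointwise.
-- 2. Symmetry.  Φ(m,n) = (-1)^n (I ⊗_{ψ_m} f)(n) satisfies, by the product
--    rule, Φ(m,n+1) = -(Φ(m,n) + Φ(m+1,n)), with Φ(m,0) = f(m); and
--    Φ(0,n) = f(n) is exactly the condition I • f = ν f.  Induction on n then
--    gives Φ(m,n) = Φ(n,m); conversely symmetry at m = 0 is the condition.
-- 3. Odd values.  Split f = a + b into even and odd parts; I • f = ν f reads
--    e^t(A+B) = A - B.  With T X = X + I • X (multiplication by 1 + e^t) and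
--    E(n) = E_n(1), the Euler recurrence says T E = 2·I, and one finds
--    T a = T (b + E ⊛ a).  Since 2 is invertible T is injective, so
--    a = b + E ⊛ a; evaluating at the odd number 2k+1 gives the formula.

open import Defs
open import Level using (Level)
open import Algebra.Bundles using (CommutativeRing)
open import Data.Nat using (ℕ; zero; suc; _∸_; _≤_; _<_; z≤n; _≟_)
  renaming (_+_ to _+ℕ_; _*_ to _*ℕ_)
import Data.Nat.Properties as ℕ
open import Data.Nat.Combinatorics using (_C_; nCn≡1; nCk+nC[k+1]≡[n+1]C[k+1]; k>n⇒nCk≡0)
open import Data.Nat.Induction using (<-rec)
open import Data.Bool using (Bool; true; false; not; if_then_else_)
open import Data.Product using (_×_; _,_)
open import Data.Empty using (⊥-elim)
open import Function.Bundles using (_⇔_; mk⇔)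
open import Relation.Nullary using (¬_; yes; no)
open import Relation.Binary.PropositionalEquality as ≡ using (_≡_)

odd∸even : ∀ {i k} → i ≤ k → (2 *ℕ k +ℕ 1) ∸ 2 *ℕ i ≡ 2 *ℕ (k ∸ i) +ℕ 1
odd∸even {i} {k} i≤k = ≡.trans (ℕ.+-∸-comm 1 (ℕ.*-monoʳ-≤ 2 i≤k))
                                (≡.cong (_+ℕ 1) (≡.sym (ℕ.*-distribˡ-∸ 2 k i)))

odd∸odd : ∀ i k → (2 *ℕ k +ℕ 1) ∸ (2 *ℕ i +ℕ 1) ≡ 2 *ℕ (k ∸ i)
odd∸odd i k = ≡.trans (≡.cong₂ _∸_ (ℕ.+-comm (2 *ℕ k) 1) (ℕ.+-comm (2 *ℕ i) 1))
                      (≡.sym (ℕ.*-distribˡ-∸ 2 k i))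

isEven : ℕ → Bool
isEven zero    = true
isEven (suc n) = not (isEven n)

isEven-double : ∀ k → isEven (2 *ℕ k) ≡ true
isEven-double zero    = ≡.refl
isEven-double (suc k) = ≡.trans (≡.cong isEven (ℕ.*-suc 2 k))
                                (≡.cong (λ b → not (not b)) (isEven-double k))

isEven-double+1 : ∀ k → isEven (2 *ℕ k +ℕ 1) ≡ false
isEven-double+1 k = ≡.trans (≡.cong isEven (ℕ.+-comm (2 *ℕ k) 1))
                            (≡.cong not (isEven-double k))

module _ {c ℓ : Level} (R : CommutativeRing c ℓ) where
  open CommutativeRing R
  open import Algebra.Properties.Ring ring
    using (-‿involutive; -‿+-comm; -0#≈0#; +-cancelʳ; +-inverseˡ-unique;
           //-rightDividesˡ; //-rightDividesʳ; \\-leftDividesʳ)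
  open import Algebra.Properties.CommutativeSemigroup +-commutativeSemigroup
    using (interchange; x∙yz≈y∙xz; xy∙z≈x∙zy; x∙yz≈xz∙y)
  open import Relation.Binary.Reasoning.Setoid setoid

  Seq : Set c
  Seq = ℕ → Carrier

  _≐_ : Seq → Seq → Set ℓ
  X ≐ Y = ∀ n → X n ≈ Y n

  _⊕_ : Seq → Seq → Seq
  (X ⊕ Y) n = X n + Y n

  Δ : Seq → Seq
  Δ X n = X (suc n)

  𝟙 : Seq
  𝟙 = I R

  _·_ : ℕ → Carrier → Carrier
  _·_ = natMul R

  Σ≤ : ℕ → Seq → Carrier
  Σ≤ = sumTo R

  Σ< : ℕ → Seq → Carrier
  Σ< = sumBelow R

  sub-add : ∀ x y → (x - y) + y ≈ x
  sub-add x y = //-rightDividesˡ y x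

  add-sub : ∀ x y → (x + y) - y ≈ x
  add-sub x y = //-rightDividesʳ y x

  neg-add-cancel : ∀ x y → - x + (x + y) ≈ y
  neg-add-cancel = \\-leftDividesʳ

  ·-cong : ∀ p {x y} → x ≈ y → p · x ≈ p · y
  ·-cong zero    _   = refl
  ·-cong (suc p) x≈y = +-cong x≈y (·-cong p x≈y)

  ·-distrib : ∀ p q x → (p +ℕ q) · x ≈ p · x + q · x
  ·-distrib zero    q x = sym (+-identityˡ _)
  ·-distrib (suc p) q x = trans (+-congˡ (·-distrib p q x)) (sym (+-assoc _ _ _))

  ·-zero : ∀ p → p · 0# ≈ 0#
  ·-zero zero    = refl
  ·-zero (suc p) = trans (+-identityˡ _) (·-zero p)

  1·x : ∀ x → 1 · x ≈ x
  1·x = +-identityʳ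

  C-diag : ∀ n x → (n C n) · x ≈ x
  C-diag n x = trans (reflexive (≡.cong (_· x) (nCn≡1 n))) (1·x x)

  pascal : ∀ n j x → (suc n C suc j) · x ≈ (n C j) · x + (n C suc j) · x
  pascal n j x = trans (reflexive (≡.cong (_· x) (≡.sym (nCk+nC[k+1]≡[n+1]C[k+1] n j))))
                       (·-distrib (n C j) (n C suc j) x)

  Σ-cong : ∀ n {g h : Seq} → (∀ i → i ≤ n → g i ≈ h i) → Σ≤ n g ≈ Σ≤ n h
  Σ-cong zero    g≈h = g≈h 0 z≤n
  Σ-cong (suc n) g≈h = +-cong (Σ-cong n (λ i i≤n → g≈h i (ℕ.m≤n⇒m≤1+n i≤n))) (g≈h (suc n) ℕ.≤-refl)

  Σ-zero : ∀ n (g : Seq) → (∀ i → i ≤ n → g i ≈ 0#) → Σ≤ n g ≈ 0#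
  Σ-zero zero    g g≈0 = g≈0 0 z≤n
  Σ-zero (suc n) g g≈0 =
    trans (+-cong (Σ-zero n g (λ i i≤n → g≈0 i (ℕ.m≤n⇒m≤1+n i≤n))) (g≈0 (suc n) ℕ.≤-refl))
          (+-identityˡ 0#)

  Σ-+ : ∀ n (g h : Seq) → Σ≤ n (g ⊕ h) ≈ Σ≤ n g + Σ≤ n h
  Σ-+ zero    g h = refl
  Σ-+ (suc n) g h = trans (+-congʳ (Σ-+ n g h)) (interchange _ _ _ _)

  Σ-first : ∀ n (g : Seq) → Σ≤ (suc n) g ≈ g 0 + Σ≤ n (Δ g)
  Σ-first zero    g = refl
  Σ-first (suc n) g = trans (+-congʳ (Σ-first n g)) (+-assoc _ _ _)

  Σ-last : ∀ n (g : Seq) → Σ≤ n g ≈ Σ< n g + g n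
  Σ-last zero    g = sym (+-identityˡ _)
  Σ-last (suc n) g = +-congʳ (Σ-last n g)

  Σ<-cong : ∀ n {g h : Seq} → (∀ i → i < n → g i ≈ h i) → Σ< n g ≈ Σ< n h
  Σ<-cong zero    g≈h = refl
  Σ<-cong (suc n) g≈h = +-cong (Σ<-cong n (λ i i<n → g≈h i (ℕ.m≤n⇒m≤1+n i<n))) (g≈h n ℕ.≤-refl)

  Σ-parity : ∀ k (g : Seq) →
    Σ≤ (2 *ℕ k +ℕ 1) g ≈ Σ≤ k (λ i → g (2 *ℕ i)) + Σ≤ k (λ i → g (2 *ℕ i +ℕ 1))
  Σ-parity zero    g = refl
  Σ-parity (suc k) g = begin
    Σ≤ (2 *ℕ suc k +ℕ 1) g                    ≡⟨ ≡.cong (λ m → Σ≤ m g) top ⟩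
    (Σ≤ N g + g (suc N)) + g (suc (suc N))    ≈⟨ +-congʳ (+-congʳ (Σ-parity k g)) ⟩
    ((Ev + Od) + g (suc N)) + g (suc (suc N)) ≈⟨ +-assoc _ _ _ ⟩
    (Ev + Od) + (g (suc N) + g (suc (suc N))) ≈⟨ interchange _ _ _ _ ⟩
    (Ev + g (suc N)) + (Od + g (suc (suc N))) ≡⟨ ≡.cong₂ (λ p q → (Ev + g p) + (Od + g q)) even (≡.sym top) ⟩
    (Ev + g (2 *ℕ suc k)) + (Od + g (2 *ℕ suc k +ℕ 1)) ∎
    where
    N  = 2 *ℕ k +ℕ 1
    Ev = Σ≤ k (λ i → g (2 *ℕ i))
    Od = Σ≤ k (λ i → g (2 *ℕ i +ℕ 1))
    top : 2 *ℕ suc k +ℕ 1 ≡ suc (suc N)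
    top = ≡.cong (_+ℕ 1) (ℕ.*-suc 2 k)
    even : suc N ≡ 2 *ℕ suc k
    even = ≡.trans (≡.cong suc (ℕ.+-comm (2 *ℕ k) 1)) (≡.sym (ℕ.*-suc 2 k))

  pascal-sum : ∀ n (u : Seq) →
    Σ≤ (suc n) (λ j → (suc n C j) · u j)
      ≈ Σ≤ n (λ j → (n C j) · u (suc j)) + Σ≤ n (λ j → (n C j) · u j)
  pascal-sum n u = begin
    Σ≤ (suc n) (λ j → (suc n C j) · u j)         ≈⟨ Σ-first n _ ⟩
    u₀ + Σ≤ n (λ j → (suc n C suc j) · u (suc j)) ≈⟨ +-congˡ (Σ-cong n (λ j _ → pascal n j (u (suc j)))) ⟩
    u₀ + Σ≤ n (shifted ⊕ rest)                   ≈⟨ +-congˡ (Σ-+ n shifted rest) ⟩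
    u₀ + (Σ≤ n shifted + Σ≤ n rest)              ≈⟨ x∙yz≈y∙xz _ _ _ ⟩
    Σ≤ n shifted + (u₀ + Σ≤ n rest)              ≈⟨ +-congˡ (Σ-first n unshifted) ⟨
    Σ≤ n shifted + Σ≤ (suc n) unshifted          ≈⟨ +-congˡ (+-congˡ vanishing) ⟩
    Σ≤ n shifted + (Σ≤ n unshifted + 0#)         ≈⟨ +-congˡ (+-identityʳ _) ⟩
    Σ≤ n shifted + Σ≤ n unshifted                ∎
    where
    u₀ = 1 · u 0
    shifted unshifted rest : Seq
    shifted   j = (n C j) · u (suc j)
    unshifted j = (n C j) · u j
    rest      j = (n C suc j) · u (suc j)
    vanishing : (n C suc n) · u (suc n) ≈ 0#
    vanishing = reflexive (≡.cong (_· u (suc n)) (k>n⇒nCk≡0 (ℕ.n<1+n n)))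

  bullet-leibniz : ∀ n X Y → bullet R X Y (suc n) ≈ bullet R (Δ X) Y n + bullet R X (Δ Y) n
  bullet-leibniz n X Y = trans (pascal-sum n (λ j → X j * Y (suc n ∸ j)))
    (+-congˡ (Σ-cong n (λ j j≤n →
      reflexive (≡.cong (λ m → (n C j) · (X j * Y m)) (ℕ.+-∸-assoc 1 j≤n)))))

  bullet-congʳ : ∀ n X {Y Y'} → Y ≐ Y' → bullet R X Y n ≈ bullet R X Y' n
  bullet-congʳ n X Y≐Y' = Σ-cong n (λ j _ → ·-cong (n C j) (*-congˡ (Y≐Y' (n ∸ j))))

  bullet-𝟙 : ∀ n X → bullet R X 𝟙 n ≈ Σ< n (λ i → (n C i) · X i) + X n
  bullet-𝟙 n X = trans (Σ-last n _)
    (+-cong (Σ<-cong n (λ i _ → ·-cong (n C i) (*-identityʳ _)))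
            (trans (C-diag n _) (*-identityʳ _)))

  _⊛_ : Seq → Seq → Seq
  (X ⊛ Y) zero    = X 0 * Y 0
  (X ⊛ Y) (suc n) = (Δ X ⊛ Y) n + (X ⊛ Δ Y) n

  ⊛-cong : ∀ {X X' Y Y'} → X ≐ X' → Y ≐ Y' → (X ⊛ Y) ≐ (X' ⊛ Y')
  ⊛-cong X≐X' Y≐Y' zero    = *-cong (X≐X' 0) (Y≐Y' 0)
  ⊛-cong X≐X' Y≐Y' (suc n) =
    +-cong (⊛-cong (λ i → X≐X' (suc i)) Y≐Y' n) (⊛-cong X≐X' (λ i → Y≐Y' (suc i)) n)

  ⊛-comm : ∀ X Y → (X ⊛ Y) ≐ (Y ⊛ X)
  ⊛-comm X Y zero    = *-comm _ _
  ⊛-comm X Y (suc n) = trans (+-cong (⊛-comm (Δ X) Y n) (⊛-comm X (Δ Y) n)) (+-comm _ _)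

  ⊛-distribˡ : ∀ X Y Z → (X ⊛ (Y ⊕ Z)) ≐ ((X ⊛ Y) ⊕ (X ⊛ Z))
  ⊛-distribˡ X Y Z zero    = distribˡ _ _ _
  ⊛-distribˡ X Y Z (suc n) =
    trans (+-cong (⊛-distribˡ (Δ X) Y Z n) (⊛-distribˡ X (Δ Y) (Δ Z) n)) (interchange _ _ _ _)

  ⊛-distribʳ : ∀ X Y Z → ((X ⊕ Y) ⊛ Z) ≐ ((X ⊛ Z) ⊕ (Y ⊛ Z))
  ⊛-distribʳ X Y Z n = begin
    ((X ⊕ Y) ⊛ Z) n           ≈⟨ ⊛-comm (X ⊕ Y) Z n ⟩
    (Z ⊛ (X ⊕ Y)) n           ≈⟨ ⊛-distribˡ Z X Y n ⟩
    (Z ⊛ X) n + (Z ⊛ Y) n     ≈⟨ +-cong (⊛-comm Z X n) (⊛-comm Z Y n) ⟩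
    (X ⊛ Z) n + (Y ⊛ Z) n     ∎

  -- Associativity: both sides obey the product rule, and Δ (Y ⊛ Z) is by
  -- definition (ΔY ⊛ Z) ⊕ (Y ⊛ ΔZ).
  ⊛-assoc : ∀ X Y Z → (X ⊛ (Y ⊛ Z)) ≐ ((X ⊛ Y) ⊛ Z)
  ⊛-assoc X Y Z zero    = sym (*-assoc _ _ _)
  ⊛-assoc X Y Z (suc n) = begin
    (Δ X ⊛ (Y ⊛ Z)) n + (X ⊛ ((Δ Y ⊛ Z) ⊕ (Y ⊛ Δ Z))) n
      ≈⟨ +-cong (⊛-assoc (Δ X) Y Z n) (⊛-distribˡ X (Δ Y ⊛ Z) (Y ⊛ Δ Z) n) ⟩
    ((Δ X ⊛ Y) ⊛ Z) n + ((X ⊛ (Δ Y ⊛ Z)) n + (X ⊛ (Y ⊛ Δ Z)) n)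
      ≈⟨ +-congˡ (+-cong (⊛-assoc X (Δ Y) Z n) (⊛-assoc X Y (Δ Z) n)) ⟩
    ((Δ X ⊛ Y) ⊛ Z) n + (((X ⊛ Δ Y) ⊛ Z) n + ((X ⊛ Y) ⊛ Δ Z) n)
      ≈⟨ sym (+-assoc _ _ _) ⟩
    (((Δ X ⊛ Y) ⊛ Z) n + ((X ⊛ Δ Y) ⊛ Z) n) + ((X ⊛ Y) ⊛ Δ Z) n
      ≈⟨ +-congʳ (sym (⊛-distribʳ (Δ X ⊛ Y) (X ⊛ Δ Y) Z n)) ⟩
    (((Δ X ⊛ Y) ⊕ (X ⊛ Δ Y)) ⊛ Z) n + ((X ⊛ Y) ⊛ Δ Z) n ∎

  -- Both convolutions satisfy the product rule with the same initial value.
  bullet≐⊛ : ∀ X Y → bullet R X Y ≐ (X ⊛ Y)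
  bullet≐⊛ X Y zero    = 1·x _
  bullet≐⊛ X Y (suc n) =
    trans (bullet-leibniz n X Y) (+-cong (bullet≐⊛ (Δ X) Y n) (bullet≐⊛ X (Δ Y) n))

  signed-cong : ∀ n {x y} → x ≈ y → signed R n x ≈ signed R n y
  signed-cong zero    x≈y = x≈y
  signed-cong (suc n) x≈y = -‿cong (signed-cong n x≈y)

  signed-+ : ∀ n x y → signed R n (x + y) ≈ signed R n x + signed R n y
  signed-+ zero    x y = refl
  signed-+ (suc n) x y = trans (-‿cong (signed-+ n x y)) (sym (-‿+-comm _ _))

  signed-neg : ∀ n x → signed R n (- x) ≈ - signed R n x
  signed-neg zero    x = refl
  signed-neg (suc n) x = -‿cong (signed-neg n x)

  signed-involutive : ∀ n x → signed R n (signed R n x) ≈ x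
  signed-involutive zero    x = refl
  signed-involutive (suc n) x =
    trans (-‿cong (signed-neg n _)) (trans (-‿involutive _) (signed-involutive n x))

  signed-parity : ∀ n x → signed R n x ≈ (if isEven n then x else - x)
  signed-parity zero    x = refl
  signed-parity (suc n) x with isEven n | signed-parity n x
  ... | true  | sx≈x  = -‿cong sx≈x
  ... | false | sx≈-x = trans (-‿cong sx≈-x) (-‿involutive x)

  BinomialSelfDual : Seq → Set ℓ
  BinomialSelfDual f = ∀ k → bullet R (I R) f k ≈ νf R f k

  ShiftSymmetric : Seq → Set ℓ
  ShiftSymmetric f =
    ∀ m n → signed R n (otimesψ R m (I R) f n) ≈ signed R m (otimesψ R n (I R) f m)

  module Symmetry (f : Seq) where
    Φ : ℕ → ℕ → Carrier
    Φ m n = signed R n (otimesψ R m (I R) f n)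

    -- The product rule, with Δ𝟙 = 𝟙, gives a Pascal-type recurrence.
    Φ-step : ∀ m n → Φ m (suc n) ≈ - (Φ m n + Φ (suc m) n)
    Φ-step m n = -‿cong (begin
      signed R n (bullet R 𝟙 (shift m) (suc n))
        ≈⟨ signed-cong n (bullet-leibniz n 𝟙 (shift m)) ⟩
      signed R n (bullet R 𝟙 (shift m) n + bullet R 𝟙 (Δ (shift m)) n)
        ≈⟨ signed-cong n (+-congˡ (bullet-congʳ n 𝟙 (λ j → reflexive (≡.cong f (ℕ.+-suc m j))))) ⟩
      signed R n (bullet R 𝟙 (shift m) n + bullet R 𝟙 (shift (suc m)) n)
        ≈⟨ signed-+ n _ _ ⟩
      Φ m n + Φ (suc m) n ∎)
      where
      shift : ℕ → Seq
      shift m j = f (m +ℕ j)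

    Φ-row : ∀ m → Φ m 0 ≈ f m
    Φ-row m = trans (1·x _) (trans (*-identityˡ _) (reflexive (≡.cong f (ℕ.+-identityʳ m))))

    Φ-column : BinomialSelfDual f → ∀ n → Φ 0 n ≈ f n
    Φ-column self-dual n = trans (signed-cong n (self-dual n)) (signed-involutive n (f n))

    Φ-symmetric : BinomialSelfDual f → ∀ m n → Φ m n ≈ Φ n m
    Φ-symmetric self-dual m zero    = trans (Φ-row m) (sym (Φ-column self-dual m))
    Φ-symmetric self-dual m (suc n) = begin
      Φ m (suc n)                      ≈⟨ Φ-step m n ⟩
      - (Φ m n + Φ (suc m) n)          ≈⟨ -‿cong (+-cong (Φ-symmetric self-dual m n)
                                                         (Φ-symmetric self-dual (suc m) n)) ⟩
      - (Φ n m + Φ n (suc m))          ≈⟨ -‿cong (+-congˡ (Φ-step n m)) ⟩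
      - (Φ n m + - (Φ n m + Φ (suc n) m)) ≈⟨ -‿+-comm _ _ ⟨
      - Φ n m + - - (Φ n m + Φ (suc n) m) ≈⟨ +-congˡ (-‿involutive _) ⟩
      - Φ n m + (Φ n m + Φ (suc n) m)  ≈⟨ neg-add-cancel _ _ ⟩
      Φ (suc n) m                      ∎

  self-dual⇒shift-symmetric : ∀ f → BinomialSelfDual f → ShiftSymmetric f
  self-dual⇒shift-symmetric f self-dual m n = Φ-symmetric self-dual m n
    where open Symmetry f

  -- The converse is the instance m = 0 of the symmetry.
  shift-symmetric⇒self-dual : ∀ f → ShiftSymmetric f → BinomialSelfDual f
  shift-symmetric⇒self-dual f symmetric k = begin
    bullet R (I R) f k                  ≈⟨ signed-involutive k _ ⟨
    signed R k (Φ 0 k)                  ≈⟨ signed-cong k (symmetric 0 k) ⟩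
    signed R k (Φ k 0)                  ≈⟨ signed-cong k (Φ-row k) ⟩
    signed R k (f k)                    ∎
    where open Symmetry f

  module OddValues (half : Carrier) (two-halves : half + half ≈ 1#) where
    halve : ∀ x → half * (x + x) ≈ x
    halve x = begin
      half * (x + x)          ≈⟨ distribˡ half x x ⟩
      half * x + half * x     ≈⟨ distribʳ x half half ⟨
      (half + half) * x       ≈⟨ *-congʳ two-halves ⟩
      1# * x                  ≈⟨ *-identityˡ x ⟩
      x                       ∎

    double-injective : ∀ {x y} → x + x ≈ y + y → x ≈ y
    double-injective {x} {y} eq = trans (sym (halve x)) (trans (*-congˡ eq) (halve y))

    -- T X = X + 𝟙 ⊛ X, i.e. multiplication of the generating function by 1 + e^t.
    T : Seq → Seq
    T X = X ⊕ (𝟙 ⊛ X)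

    T-expand : ∀ X n → T X n ≈ (X n + X n) + Σ< n (λ i → (n C i) · X i)
    T-expand X n = begin
      X n + (𝟙 ⊛ X) n                            ≈⟨ +-congˡ (⊛-comm 𝟙 X n) ⟩
      X n + (X ⊛ 𝟙) n                            ≈⟨ +-congˡ (bullet≐⊛ X 𝟙 n) ⟨
      X n + bullet R X 𝟙 n                       ≈⟨ +-congˡ (bullet-𝟙 n X) ⟩
      X n + (Σ< n (λ i → (n C i) · X i) + X n)  ≈⟨ x∙yz≈xz∙y _ _ _ ⟩
      (X n + X n) + Σ< n (λ i → (n C i) · X i)  ∎

    -- T is injective: the coefficient of X(n) in T X n is 2, the rest
    -- involves only X(i) for i < n.
    T-injective : ∀ {X Y} → T X ≐ T Y → X ≐ Y
    T-injective {X} {Y} TX≐TY = <-rec (λ n → X n ≈ Y n) step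
      where
      step : ∀ n → (∀ {i} → i < n → X i ≈ Y i) → X n ≈ Y n
      step n below = double-injective (+-cancelʳ (Σ< n (λ i → (n C i) · Y i)) _ _ (begin
        (X n + X n) + Σ< n (λ i → (n C i) · Y i) ≈⟨ +-congˡ (Σ<-cong n (λ i i<n → ·-cong (n C i) (below i<n))) ⟨
        (X n + X n) + Σ< n (λ i → (n C i) · X i) ≈⟨ T-expand X n ⟨
        T X n                                    ≈⟨ TX≐TY n ⟩
        T Y n                                    ≈⟨ T-expand Y n ⟩
        (Y n + Y n) + Σ< n (λ i → (n C i) · Y i) ∎))

    T-additive : ∀ X Y → T (X ⊕ Y) ≐ (T X ⊕ T Y)
    T-additive X Y n = trans (+-congˡ (⊛-distribˡ 𝟙 X Y n)) (interchange _ _ _ _)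

    T-⊛ : ∀ X Y → T (X ⊛ Y) ≐ (T X ⊛ Y)
    T-⊛ X Y n = trans (+-congˡ (⊛-assoc 𝟙 X Y n)) (sym (⊛-distribʳ X (𝟙 ⊛ X) Y n))

    E₁ : Seq
    E₁ n = euler R half n 1#

    table : ℕ → ℕ → Carrier
    table = eulerTable R half 1#

    table-new : ∀ n → table (suc n) n ≡ pow R 1# n - half * Σ< n (λ i → (n C i) · table n i)
    table-new n with n ≟ n
    ... | yes _   = ≡.refl
    ... | no  n≢n = ⊥-elim (n≢n ≡.refl)

    table-correct : ∀ n i → i < n → table n i ≡ E₁ i
    table-correct (suc n) i i<1+n with i ≟ n
    ... | yes ≡.refl = ≡.sym (table-new i)
    ... | no  i≢n    = table-correct n i (ℕ.≤∧≢⇒< (ℕ.≤-pred i<1+n) i≢n)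

    pow-1# : ∀ k → pow R 1# k ≈ 1#
    pow-1# zero    = refl
    pow-1# (suc k) = trans (*-identityˡ _) (pow-1# k)

    E₁-recurrence : ∀ n → E₁ n ≈ 1# - half * Σ< n (λ i → (n C i) · E₁ i)
    E₁-recurrence n = trans (reflexive (table-new n))
      (+-cong (pow-1# n) (-‿cong (*-congˡ (Σ<-cong n (λ i i<n →
        reflexive (≡.cong ((n C i) ·_) (table-correct n i i<n)))))))

    T-E₁ : T E₁ ≐ (𝟙 ⊕ 𝟙)
    T-E₁ n = begin
      T E₁ n                                ≈⟨ T-expand E₁ n ⟩
      (E₁ n + E₁ n) + s                     ≈⟨ +-congʳ (+-cong (E₁-recurrence n) (E₁-recurrence n)) ⟩
      ((1# - half * s) + (1# - half * s)) + s ≈⟨ +-congʳ (interchange _ _ _ _) ⟩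
      ((1# + 1#) + (- (half * s) + - (half * s))) + s ≈⟨ +-congʳ (+-congˡ (-‿+-comm _ _)) ⟩
      ((1# + 1#) - (half * s + half * s)) + s ≈⟨ +-congʳ (+-congˡ (-‿cong (distribʳ s half half))) ⟨
      ((1# + 1#) - ((half + half) * s)) + s ≈⟨ +-congʳ (+-congˡ (-‿cong (trans (*-congʳ two-halves) (*-identityˡ s)))) ⟩
      ((1# + 1#) - s) + s                   ≈⟨ sub-add _ _ ⟩
      1# + 1#                               ∎
      where
      s = Σ< n (λ i → (n C i) · E₁ i)

    evenPart oddPart : Seq → Seq
    evenPart f n = if isEven n then f n else 0#
    oddPart  f n = if isEven n then 0# else f n

    evenPart-even : ∀ f m → evenPart f (2 *ℕ m) ≈ f (2 *ℕ m)
    evenPart-even f m = reflexive (≡.cong (λ p → if p then f (2 *ℕ m) else 0#) (isEven-double m))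

    evenPart-odd : ∀ f m → evenPart f (2 *ℕ m +ℕ 1) ≈ 0#
    evenPart-odd f m = reflexive (≡.cong (λ p → if p then f (2 *ℕ m +ℕ 1) else 0#) (isEven-double+1 m))

    oddPart-odd : ∀ f m → oddPart f (2 *ℕ m +ℕ 1) ≈ f (2 *ℕ m +ℕ 1)
    oddPart-odd f m = reflexive (≡.cong (λ p → if p then 0# else f (2 *ℕ m +ℕ 1)) (isEven-double+1 m))

    parts-sum : ∀ f → (evenPart f ⊕ oddPart f) ≐ f
    parts-sum f n with isEven n
    ... | true  = +-identityʳ (f n)
    ... | false = +-identityˡ (f n)

    parts-signed : ∀ f n → evenPart f n - oddPart f n ≈ νf R f n
    parts-signed f n with isEven n | signed-parity n (f n)
    ... | true  | sf≈f  = trans (+-congˡ -0#≈0#) (trans (+-identityʳ _) (sym sf≈f))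
    ... | false | sf≈-f = trans (+-identityˡ _) (sym sf≈-f)

    bullet-evenPart : ∀ X f k →
      bullet R X (evenPart f) (2 *ℕ k +ℕ 1)
        ≈ Σ≤ k (λ i → ((2 *ℕ k +ℕ 1) C (2 *ℕ i +ℕ 1)) · (X (2 *ℕ i +ℕ 1) * f (2 *ℕ (k ∸ i))))
    bullet-evenPart X f k = begin
      Σ≤ N term                                                    ≈⟨ Σ-parity k term ⟩
      Σ≤ k (λ i → term (2 *ℕ i)) + Σ≤ k (λ i → term (2 *ℕ i +ℕ 1)) ≈⟨ +-cong (Σ-zero k _ even-term) (Σ-cong k odd-term) ⟩
      0# + Σ≤ k odd-summand                                        ≈⟨ +-identityˡ _ ⟩
      Σ≤ k odd-summand                                             ∎
      where
      N = 2 *ℕ k +ℕ 1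
      term odd-summand : Seq
      term j = (N C j) · (X j * evenPart f (N ∸ j))
      odd-summand i = (N C (2 *ℕ i +ℕ 1)) · (X (2 *ℕ i +ℕ 1) * f (2 *ℕ (k ∸ i)))
      even-term : ∀ i → i ≤ k → term (2 *ℕ i) ≈ 0#
      even-term i i≤k = trans (·-cong (N C (2 *ℕ i)) (trans (*-congˡ vanishes) (zeroʳ _)))
                              (·-zero (N C (2 *ℕ i)))
        where
        vanishes : evenPart f (N ∸ 2 *ℕ i) ≈ 0#
        vanishes = trans (reflexive (≡.cong (evenPart f) (odd∸even i≤k))) (evenPart-odd f (k ∸ i))
      odd-term : ∀ i → i ≤ k → term (2 *ℕ i +ℕ 1) ≈ odd-summand i
      odd-term i _ = ·-cong (N C (2 *ℕ i +ℕ 1)) (*-congˡ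
        (trans (reflexive (≡.cong (evenPart f) (odd∸odd i k))) (evenPart-even f (k ∸ i))))

    module _ (f : Seq) (self-dual : BinomialSelfDual f) where
      a b : Seq
      a = evenPart f
      b = oddPart f

      -- e^t (A + B) = A - B, rearranged: (1 + e^t) B = A - e^t A.
      T-oddPart : T b ≐ (λ n → a n - (𝟙 ⊛ a) n)
      T-oddPart n = begin
        b n + (𝟙 ⊛ b) n                         ≈⟨ add-sub _ _ ⟨
        ((b n + (𝟙 ⊛ b) n) + (𝟙 ⊛ a) n) - (𝟙 ⊛ a) n ≈⟨ +-congʳ (xy∙z≈x∙zy _ _ _) ⟩
        (b n + ((𝟙 ⊛ a) n + (𝟙 ⊛ b) n)) - (𝟙 ⊛ a) n ≈⟨ +-congʳ (+-congˡ whole) ⟩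
        (b n + (a n - b n)) - (𝟙 ⊛ a) n          ≈⟨ +-congʳ (trans (+-comm _ _) (sub-add _ _)) ⟩
        a n - (𝟙 ⊛ a) n                          ∎
        where
        whole : (𝟙 ⊛ a) n + (𝟙 ⊛ b) n ≈ a n - b n
        whole = begin
          (𝟙 ⊛ a) n + (𝟙 ⊛ b) n     ≈⟨ ⊛-distribˡ 𝟙 a b n ⟨
          (𝟙 ⊛ (a ⊕ b)) n          ≈⟨ ⊛-cong (λ _ → refl) (parts-sum f) n ⟩
          (𝟙 ⊛ f) n                ≈⟨ bullet≐⊛ 𝟙 f n ⟨
          bullet R 𝟙 f n           ≈⟨ self-dual n ⟩
          νf R f n                 ≈⟨ parts-signed f n ⟨
          a n - b n                ∎

      odd-from-even : a ≐ (b ⊕ (E₁ ⊛ a))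
      odd-from-even = T-injective λ n → sym (begin
        T (b ⊕ (E₁ ⊛ a)) n                      ≈⟨ T-additive b (E₁ ⊛ a) n ⟩
        T b n + T (E₁ ⊛ a) n                    ≈⟨ +-cong (T-oddPart n) (T-⊛ E₁ a n) ⟩
        (a n - (𝟙 ⊛ a) n) + (T E₁ ⊛ a) n        ≈⟨ +-congˡ (⊛-cong T-E₁ (λ _ → refl) n) ⟩
        (a n - (𝟙 ⊛ a) n) + ((𝟙 ⊕ 𝟙) ⊛ a) n     ≈⟨ +-congˡ (⊛-distribʳ 𝟙 𝟙 a n) ⟩
        (a n - (𝟙 ⊛ a) n) + ((𝟙 ⊛ a) n + (𝟙 ⊛ a) n) ≈⟨ +-assoc _ _ _ ⟩
        a n + (- (𝟙 ⊛ a) n + ((𝟙 ⊛ a) n + (𝟙 ⊛ a) n)) ≈⟨ +-congˡ (neg-add-cancel _ _) ⟩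
        T a n                                   ∎)

      odd-values : ∀ k → f (2 *ℕ k +ℕ 1) ≈
        - Σ≤ k (λ i → ((2 *ℕ k +ℕ 1) C (2 *ℕ i +ℕ 1)) · (E₁ (2 *ℕ i +ℕ 1) * f (2 *ℕ (k ∸ i))))
      odd-values k = begin
        f N                      ≈⟨ oddPart-odd f k ⟨
        b N                      ≈⟨ +-inverseˡ-unique _ _ (trans (sym (odd-from-even N)) (evenPart-odd f k)) ⟩
        - (E₁ ⊛ a) N             ≈⟨ -‿cong (bullet≐⊛ E₁ a N) ⟨
        - bullet R E₁ a N        ≈⟨ -‿cong (bullet-evenPart E₁ f k) ⟩
        - Σ≤ k (λ i → (N C (2 *ℕ i +ℕ 1)) · (E₁ (2 *ℕ i +ℕ 1) * f (2 *ℕ (k ∸ i)))) ∎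
        where
        N = 2 *ℕ k +ℕ 1

-- The paper's Theorem 5.
theorem5 : {c ℓ : Level} (R : CommutativeRing c ℓ) →
    let open CommutativeRing R in
    (inv : ℕ → Carrier) → (∀ n → natMul R (suc n) (inv n) ≈ 1#) →
    (f : ℕ → Carrier) → ¬ (f 0 ≈ 0#) →
    ((∀ m n → signed R n (otimesψ R m (I R) f n) ≈ signed R m (otimesψ R n (I R) f m))
      ⇔ (∀ k → bullet R (I R) f k ≈ νf R f k))
    × ((∀ k → bullet R (I R) f k ≈ νf R f k) →
       ∀ k → f (2 *ℕ k +ℕ 1) ≈
         - sumTo R k (λ i → natMul R ((2 *ℕ k +ℕ 1) C (2 *ℕ i +ℕ 1))
                                    (euler R (inv 1) (2 *ℕ i +ℕ 1) 1# * f (2 *ℕ (k ∸ i)))))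
theorem5 R inv inv-spec f _ =
  mk⇔ (shift-symmetric⇒self-dual R f) (self-dual⇒shift-symmetric R f) ,
  OddValues.odd-values R (inv 1) two-halves f
  where
  open CommutativeRing R
  -- inv 1 is a half: 2 · inv 1 = inv 1 + (inv 1 + 0) = 1.
  two-halves : inv 1 + inv 1 ≈ 1#
  two-halves = trans (+-congˡ (sym (+-identityʳ (inv 1)))) (inv-spec 1)
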